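{- Let $n$ be a positive integer with $\gcd(n,6)=1$ and let $S=(x_1)(x_2)(x_3)(x_4)$ be a minimal zero-sum sequence over $\mathbb{Z}/n$ with integers $1\le x_i<n$. Suppose $\mathrm{ind}(S)=2$, $x_1=1$, $x_2+1=x_3$, and $\gcd(x_i,n)=1$ for all $i$. Then $x_4<x_2$.
   Context: A sequence is minimal zero-sum if its terms sum to $0$ and no proper nontrivial subsequence sums to $0$. For a generator $g$ of $\mathbb{Z}/n$, writing $S=(y_1g)\cdots(y_4g)$ with $1\le y_i\le n$, the $g$-norm is $\|S\|_g=\frac{1}{n}\sum y_i$, and $\mathrm{ind}(S)=\min_g\|S\|_g$ over all generators $g$. -}

module Defs where

open import Data.Nat using (ℕ; zero; suc; _+_; _*_; _≤_; _<_; NonZero)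
open import Data.Nat.DivMod using (_%_)
open import Data.Nat.GCD using (gcd)
open import Data.Fin using (Fin; zero; suc)
open import Data.Fin.Subset using (Subset; _∈_; ⊥; ⊤)
open import Data.Vec using (Vec; []; _∷_)
open import Data.Bool using (Bool; true; false)
open import Data.Product using (Σ; _×_; ∃; ∃-syntax)
open import Relation.Binary.PropositionalEquality using (_≡_; _≢_)

-- A length-4 sequence over ℤ/n, given by integer representatives.
Seq4 : Set
Seq4 = Fin 4 → ℕ

total : Seq4 → ℕ
total x = x zero + x (suc zero) + x (suc (suc zero)) + x (suc (suc (suc zero)))

subsetSum : ∀ {k} → (Fin k → ℕ) → Subset k → ℕ
subsetSum x []            = 0
subsetSum x (true  ∷ s) = x zero + subsetSum (λ i → x (suc i)) s
subsetSum x (false ∷ s) = subsetSum (λ i → x (suc i)) s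

MinimalZeroSum : (n : ℕ) .{{_ : NonZero n}} → Seq4 → Set
MinimalZeroSum n x =
  (total x % n ≡ 0) ×
  (∀ (s : Subset 4) → s ≢ ⊥ → s ≢ ⊤ → subsetSum x s % n ≢ 0)

Generator : ℕ → ℕ → Set
Generator n g = (1 ≤ g) × (g ≤ n) × (gcd g n ≡ 1)

Coords : (n : ℕ) .{{_ : NonZero n}} → ℕ → Seq4 → Seq4 → Set
Coords n g x y = ∀ i → (1 ≤ y i) × (y i ≤ n) × ((y i * g) % n ≡ x i % n)

-- ind(S) = k, i.e. min over generators g of ‖S‖_g = (1/n) Σ y_i equals k:
-- the value k·n of Σ y_i is attained for some generator, and
-- every generator gives Σ y_i ≥ k·n.
IndEq : (n : ℕ) .{{_ : NonZero n}} → Seq4 → ℕ → Set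
IndEq n x k =
  (∃[ g ] ∃[ y ] (Generator n g × Coords n g x y × total y ≡ k * n)) ×
  (∀ g y → Generator n g → Coords n g x y → k * n ≤ total y)

-- Indexing the terms x₀, …, x₃ as in Fin 4: with g = 1 the index bound and
-- x₀ + x₁ = x₂ < n force x₀ + x₁ + x₂ + x₃ = 2n. If x₃ ≥ x₁, this and minimality
-- (x₀ + x₃ ≢ 0) force x₁, x₂, x₃ > n/2. Since n is odd, g = (n+1)/2 is a generator with
-- 2g ≡ 1, and the g-coordinates are yᵢ = 2xᵢ − kᵢ n with k = (0,1,1,1), so
-- Σ yᵢ = 2·2n − 3n = n: the sequence would have index 1, not 2.
module Submission where

open import Defs
open import Data.Nat using (ℕ; zero; suc; _+_; _*_; _/_; _%_; _≤_; _<_; z≤n; s≤s; NonZero; _<?_)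
open import Data.Nat.Properties
open import Data.Nat.DivMod using (m≡m%n+[m/n]*n; [m+kn]%n≡m%n; n%n≡0)
open import Data.Nat.Divisibility using (_∣_; divides; ∣1⇒≡1)
open import Data.Nat.GCD using (gcd; gcd-greatest; gcd-zeroˡ)
open import Data.Nat.Coprimality as Coprime using (Coprime; coprime-+; 1-coprimeTo; coprime⇒gcd≡1)
open import Data.Nat.Solver using (module +-*-Solver)
open import Data.Fin using (zero; suc)
open import Data.Vec using (_∷_; [])
open import Data.Bool using (true; false)
open import Data.Product using (_,_; proj₁; proj₂; ∃-syntax)
open import Data.Sum using (_⊎_; inj₁; inj₂)
open import Data.Empty using (⊥-elim)
open import Relation.Nullary using (¬_; yes; no)
open import Relation.Binary.PropositionalEquality
  using (_≡_; _≢_; refl; sym; trans; cong; cong₂; subst; module ≡-Reasoning)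

open +-*-Solver

module Terms (x : Seq4) where
  x₀ x₁ x₂ x₃ : ℕ
  x₀ = x zero
  x₁ = x (suc zero)
  x₂ = x (suc (suc zero))
  x₃ = x (suc (suc (suc zero)))

even-or-odd : ∀ n → (∃[ m ] n ≡ m + m) ⊎ (∃[ m ] n ≡ suc m + m)
even-or-odd zero = inj₁ (0 , refl)
even-or-odd (suc n) with even-or-odd n
... | inj₁ (m , refl) = inj₂ (m , refl)
... | inj₂ (m , refl) = inj₁ (suc m , cong suc (sym (+-suc m m)))

coprimeTo6⇒odd : ∀ n → gcd n 6 ≡ 1 → ∃[ m ] n ≡ suc m + m
coprimeTo6⇒odd n gcd≡1 with even-or-odd n
... | inj₂ odd = odd
... | inj₁ (m , n≡m+m) = ⊥-elim (2≢1 (∣1⇒≡1 (subst (2 ∣_) gcd≡1 (gcd-greatest 2∣n (divides 3 refl)))))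
  where
  2≢1 : 2 ≢ 1
  2≢1 ()
  2∣n : 2 ∣ n
  2∣n = divides m (trans n≡m+m (solve 1 (λ m → m :+ m := m :* con 2) refl m))

multiple-squeeze : ∀ k n t .{{_ : NonZero n}} →
  t % n ≡ 0 → k * n ≤ t → t < suc k * n → t ≡ k * n
multiple-squeeze k n t t%n≡0 lower upper = trans t≡q*n (cong (_* n) q≡k)
  where
  q : ℕ
  q = t / n
  t≡q*n : t ≡ q * n
  t≡q*n = trans (m≡m%n+[m/n]*n t n) (cong (_+ q * n) t%n≡0)
  q≡k : q ≡ k
  q≡k = ≤-antisym (≤-pred (*-cancelʳ-< n q (suc k) (subst (_< suc k * n) t≡q*n upper)))
                  (*-cancelʳ-≤ k q n (subst (k * n ≤_) t≡q*n lower))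

term≤total : ∀ x i → x i ≤ total x
term≤total x zero = ≤-trans (≤-trans (m≤m+n x₀ x₁) (m≤m+n (x₀ + x₁) x₂)) (m≤m+n (x₀ + x₁ + x₂) x₃)
  where open Terms x
term≤total x (suc zero) = ≤-trans (≤-trans (m≤n+m x₁ x₀) (m≤m+n (x₀ + x₁) x₂)) (m≤m+n (x₀ + x₁ + x₂) x₃)
  where open Terms x
term≤total x (suc (suc zero)) = ≤-trans (m≤n+m x₂ (x₀ + x₁)) (m≤m+n (x₀ + x₁ + x₂) x₃)
  where open Terms x
term≤total x (suc (suc (suc zero))) = m≤n+m x₃ (x₀ + x₁ + x₂)
  where open Terms x

total-linear : ∀ (x y k : Seq4) n → (∀ i → y i + k i * n ≡ 2 * x i) →
  total y + total k * n ≡ 2 * total x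
total-linear x y k n eq = begin
  total y + total k * n
    ≡⟨ solve 9 (λ y₀ y₁ y₂ y₃ k₀ k₁ k₂ k₃ n →
         y₀ :+ y₁ :+ y₂ :+ y₃ :+ (k₀ :+ k₁ :+ k₂ :+ k₃) :* n
         := (y₀ :+ k₀ :* n) :+ (y₁ :+ k₁ :* n) :+ (y₂ :+ k₂ :* n) :+ (y₃ :+ k₃ :* n))
         refl y₀ y₁ y₂ y₃ k₀ k₁ k₂ k₃ n ⟩
  (y₀ + k₀ * n) + (y₁ + k₁ * n) + (y₂ + k₂ * n) + (y₃ + k₃ * n)
    ≡⟨ cong₂ _+_ (cong₂ _+_ (cong₂ _+_ (eq zero) (eq (suc zero))) (eq (suc (suc zero)))) (eq (suc (suc (suc zero)))) ⟩
  2 * x₀ + 2 * x₁ + 2 * x₂ + 2 * x₃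
    ≡⟨ solve 4 (λ x₀ x₁ x₂ x₃ → con 2 :* x₀ :+ con 2 :* x₁ :+ con 2 :* x₂ :+ con 2 :* x₃
                               := con 2 :* (x₀ :+ x₁ :+ x₂ :+ x₃)) refl x₀ x₁ x₂ x₃ ⟩
  2 * total x ∎
  where
  open ≡-Reasoning
  open Terms x
  open Terms y renaming (x₀ to y₀; x₁ to y₁; x₂ to y₂; x₃ to y₃)
  open Terms k renaming (x₀ to k₀; x₁ to k₁; x₂ to k₂; x₃ to k₃)

one-generator : ∀ n → 1 ≤ n → Generator n 1
one-generator n 1≤n = s≤s z≤n , 1≤n , gcd-zeroˡ n

identity-coords : ∀ n .{{_ : NonZero n}} x → (∀ i → 1 ≤ x i) → (∀ i → x i ≤ n) → Coords n 1 x x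
identity-coords n x 1≤x x≤n i = 1≤x i , x≤n i , cong (_% n) (*-identityʳ (x i))

halving-generator : ∀ m → Generator (suc m + m) (suc m)
halving-generator m = s≤s z≤n , m≤m+n (suc m) m , coprime⇒gcd≡1 (Coprime.sym coprime)
  where
  suc-coprime : Coprime (suc m) m
  suc-coprime = subst (λ k → Coprime k m) (+-comm m 1) (coprime-+ (1-coprimeTo m))
  coprime : Coprime (suc m + m) (suc m)
  coprime = coprime-+ (Coprime.sym suc-coprime)

-- (n + 1)/2 inverts 2 modulo n = 2m + 1: the coordinate of x is any y ≡ 2x (mod n).
halving-coord : ∀ m x y k → y + k * (suc m + m) ≡ 2 * x →
  (y * suc m) % (suc m + m) ≡ x % (suc m + m)
halving-coord m x y k y+kn≡2x = begin
  (y * h) % n              ≡⟨ [m+kn]%n≡m%n (y * h) (k * h) n ⟨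
  (y * h + k * h * n) % n  ≡⟨ cong (_% n) y*h+k*h*n≡x+x*n ⟩
  (x + x * n) % n          ≡⟨ [m+kn]%n≡m%n x x n ⟩
  x % n                    ∎
  where
  open ≡-Reasoning
  h n : ℕ
  h = suc m
  n = suc m + m
  y*h+k*h*n≡x+x*n : y * h + k * h * n ≡ x + x * n
  y*h+k*h*n≡x+x*n = begin
    y * h + k * h * n  ≡⟨ solve 3 (λ y k m → y :* (con 1 :+ m) :+ k :* (con 1 :+ m) :* (con 1 :+ m :+ m)
                                          := (y :+ k :* (con 1 :+ m :+ m)) :* (con 1 :+ m)) refl y k m ⟩
    (y + k * n) * h    ≡⟨ cong (_* h) y+kn≡2x ⟩
    2 * x * h          ≡⟨ solve 2 (λ x m → con 2 :* x :* (con 1 :+ m) := x :+ x :* (con 1 :+ m :+ m)) refl x m ⟩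
    x + x * n          ∎

halving-coords : ∀ m (x y k : Seq4) → (∀ i → 1 ≤ y i) → (∀ i → y i + k i * (suc m + m) ≡ 2 * x i) →
  total y ≡ suc m + m → Coords (suc m + m) (suc m) x y
halving-coords m x y k 1≤y doubled total≡n i =
  1≤y i , subst (y i ≤_) total≡n (term≤total y i) , halving-coord m (x i) (y i) (k i) (doubled i)

2n≰n : ∀ n .{{_ : NonZero n}} → ¬ 2 * n ≤ n
2n≰n n 2n≤n with *-cancelʳ-≤ 2 1 n (subst (2 * n ≤_) (sym (*-identityˡ n)) 2n≤n)
... | s≤s ()

sum≡2n⇒m<a : ∀ m a b → b < m + m → suc a + suc a + b ≡ 2 * (suc m + m) → m < a
sum≡2n⇒m<a m a b b<2m sum≡2n with m <? a
... | yes m<a = m<a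
... | no m≮a = ⊥-elim (<-irrefl sum≡2n (begin-strict
  suc a + suc a + b      <⟨ +-mono-≤-< (+-mono-≤ a+1≤m+1 a+1≤m+1) b<2m ⟩
  suc m + suc m + (m + m) ≡⟨ solve 1 (λ m → con 1 :+ m :+ (con 1 :+ m) :+ (m :+ m) := con 2 :* (con 1 :+ m :+ m)) refl m ⟩
  2 * (suc m + m)         ∎))
  where
  open ≤-Reasoning
  a+1≤m+1 : suc a ≤ suc m
  a+1≤m+1 = s≤s (≮⇒≥ m≮a)

module IndexTwo (m : ℕ) (x : Seq4) (1≤x : ∀ i → 1 ≤ x i) (x<n : ∀ i → x i < suc m + m)
  (minimal : MinimalZeroSum (suc m + m) x)
  (index≥2 : ∀ g y → Generator (suc m + m) g → Coords (suc m + m) g x y → 2 * (suc m + m) ≤ total y)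
  (x₀≡1 : x zero ≡ 1) (x₁+1≡x₂ : x (suc zero) + 1 ≡ x (suc (suc zero))) where

  open Terms x

  n : ℕ
  n = suc m + m

  x₂≡1+x₁ : x₂ ≡ suc x₁
  x₂≡1+x₁ = trans (sym x₁+1≡x₂) (+-comm x₁ 1)

  total≡x₂+x₂+x₃ : total x ≡ suc x₁ + suc x₁ + x₃
  total≡x₂+x₂+x₃ = cong₂ (λ u v → u + x₁ + v + x₃) x₀≡1 x₂≡1+x₁

  total≡2n : total x ≡ 2 * n
  total≡2n = multiple-squeeze 2 n (total x) (proj₁ minimal)
    (index≥2 1 x (one-generator n (s≤s z≤n)) (identity-coords n x 1≤x (λ i → <⇒≤ (x<n i))))
    (subst (_< 3 * n) (sym total≡x₂+x₂+x₃) total<3n)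
    where
    x₂<n : suc x₁ < n
    x₂<n = subst (_< n) x₂≡1+x₁ (x<n (suc (suc zero)))
    total<3n : suc x₁ + suc x₁ + x₃ < 3 * n
    total<3n = subst (suc x₁ + suc x₁ + x₃ <_) (solve 1 (λ n → n :+ n :+ n := con 3 :* n) refl n)
      (+-mono-< (+-mono-< x₂<n x₂<n) (x<n (suc (suc (suc zero)))))

  x₃≢2m : x₃ ≢ m + m
  x₃≢2m x₃≡2m = proj₂ minimal (true ∷ false ∷ false ∷ true ∷ []) (λ ()) (λ ())
    (trans (cong (_% n) x₀+x₃≡n) (n%n≡0 n))
    where
    x₀+x₃≡n : x₀ + (x₃ + 0) ≡ n
    x₀+x₃≡n = cong₂ _+_ x₀≡1 (trans (+-identityʳ x₃) x₃≡2m)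

  m<x₁ : m < x₁
  m<x₁ = sum≡2n⇒m<a m x₁ x₃ (≤∧≢⇒< (≤-pred (x<n (suc (suc (suc zero))))) x₃≢2m)
    (trans (sym total≡x₂+x₂+x₃) total≡2n)

  carries : Seq4
  carries zero = 0
  carries (suc _) = 1

  -- yᵢ = 2xᵢ − carriesᵢ·n, written for x₁ = m + 1 + c, x₂ = m + 1 + (c + 1), x₃ = m + 1 + d.
  halved : ℕ → ℕ → Seq4
  halved c d zero = 2
  halved c d (suc zero) = suc (c + c)
  halved c d (suc (suc zero)) = suc (suc c + suc c)
  halved c d (suc (suc (suc zero))) = suc (d + d)

  x₁≰x₃ : ¬ x₁ ≤ x₃
  x₁≰x₃ x₁≤x₃ with m≤n⇒∃[o]m+o≡n m<x₁ | m≤n⇒∃[o]m+o≡n (≤-trans m<x₁ x₁≤x₃)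
  ... | c , m+1+c≡x₁ | d , m+1+d≡x₃ =
    2n≰n n (subst (2 * n ≤_) total-y≡n
      (index≥2 (suc m) y (halving-generator m) (halving-coords m x y carries 1≤y doubled total-y≡n)))
    where
    y : Seq4
    y = halved c d
    1≤y : ∀ i → 1 ≤ y i
    1≤y zero = s≤s z≤n
    1≤y (suc zero) = s≤s z≤n
    1≤y (suc (suc zero)) = s≤s z≤n
    1≤y (suc (suc (suc zero))) = s≤s z≤n
    odd+n≡2x : ∀ e → suc (e + e) + 1 * n ≡ 2 * (suc m + e)
    odd+n≡2x e = solve 2 (λ e m → con 1 :+ (e :+ e) :+ con 1 :* (con 1 :+ m :+ m) := con 2 :* (con 1 :+ m :+ e)) refl e m
    doubled : ∀ i → y i + carries i * n ≡ 2 * x i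
    doubled zero = cong (2 *_) (sym x₀≡1)
    doubled (suc zero) = trans (odd+n≡2x c) (cong (2 *_) m+1+c≡x₁)
    doubled (suc (suc zero)) =
      trans (odd+n≡2x (suc c)) (cong (2 *_) (trans (+-suc (suc m) c) (trans (cong suc m+1+c≡x₁) (sym x₂≡1+x₁))))
    doubled (suc (suc (suc zero))) = trans (odd+n≡2x d) (cong (2 *_) m+1+d≡x₃)
    total-y≡n : total y ≡ n
    total-y≡n = +-cancelʳ-≡ (3 * n) (total y) n (begin
      total y + 3 * n  ≡⟨ total-linear x y carries n doubled ⟩
      2 * total x      ≡⟨ cong (2 *_) total≡2n ⟩
      2 * (2 * n)      ≡⟨ solve 1 (λ n → con 2 :* (con 2 :* n) := n :+ con 3 :* n) refl n ⟩
      n + 3 * n        ∎)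
      where open ≡-Reasoning

lemma3 : (n : ℕ) .{{_ : NonZero n}} → gcd n 6 ≡ 1 →
    (x : Seq4) → (∀ i → 1 ≤ x i) → (∀ i → x i < n) →
    MinimalZeroSum n x → IndEq n x 2 →
    x zero ≡ 1 → x (suc zero) + 1 ≡ x (suc (suc zero)) →
    (∀ i → gcd (x i) n ≡ 1) →
    x (suc (suc (suc zero))) < x (suc zero)
lemma3 n coprime6 x 1≤x x<n minimal (_ , index≥2) x₀≡1 x₁+1≡x₂ _ with coprimeTo6⇒odd n coprime6
... | m , refl = ≰⇒> (IndexTwo.x₁≰x₃ m x 1≤x x<n minimal index≥2 x₀≡1 x₁+1≡x₂)
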